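{- Let $\langle\mathbf{A}_{\mathrm d},\mathbf{A},\iota\rangle$ be a (generalized) additive quantale with multiplication, let $\mathbf{Q}$ be an $\mathbf{A}$-module and let $\gamma$ be a structural nucleus on $\mathbf{Q}$. Then $\mathbf{Q}_\gamma$ is an $\mathbf{A}$-module with respect to the action $a\ast_\gamma x:=\gamma(a\ast x)$.
   Context: Fix one of two parallel settings: plain ("joins" = joins of arbitrary families) or generalized ("joins" = joins of non-empty families). A (generalized) quantale is $\langle Q,\bigvee,+,\mathsf{0}\rangle$ with $Q$ a poset having all such joins, $\langle Q,+,\mathsf{0}\rangle$ a monoid with $+$ order-preserving and distributing over such joins on both sides. A (generalized) additive quantale with multiplication is a triple $\langle\mathbf{A}_{\mathrm d},\mathbf{A},\iota\rangle$: $\mathbf{A}_{\mathrm d}$ a monoid, $\mathbf{A}$ a (generalized) quantale with an additional monoid structure $\langle A,\cdot,\mathsf 1\rangle$, $\iota\colon\mathbf{A}_{\mathrm d}\to\mathbf{A}$ a monoid homomorphism, such that $(\bigvee_i a_i)\cdot b=\bigvee_i(a_i\cdot b)$, $(a+b)\cdot c=a\cdot c+b\cdot c$, $\mathsf0\cdot a=\mathsf0$, and for $d\in\mathbf{A}_{\mathrm d}$ left multiplication by $\iota(d)$ preserves joins, $+$ and $\mathsf0$. An $\mathbf{A}$-module is a (generalized) quantale $\mathbf{Q}$ with a map $\ast\colon A\times Q\to Q$, order-preserving in both coordinates, with $(a\cdot b)\ast x=a\ast(b\ast x)$, $\mathsf1\ast x=x$, $(a+b)\ast x=a\ast x+b\ast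 x$, $\mathsf0\ast x=\mathsf0$, $(\bigvee_i a_i)\ast x=\bigvee_i(a_i\ast x)$, and for $d\in\mathbf{A}_{\mathrm d}$ the map $x\mapsto\iota(d)\ast x$ preserves $+$, $\mathsf0$ and joins. A nucleus on $\mathbf{Q}$ is an order-preserving, expansive ($x\le\gamma(x)$), idempotent map $\gamma$ with $\gamma(x)+\gamma(y)\leq\gamma(x+y)$; it is structural if $a\ast\gamma(x)\leq\gamma(a\ast x)$ for all $a\in A$, $x\in Q$. $\mathbf{Q}_\gamma$ is the (generalized) quantale on the set $\gamma[Q]$ with $\bigvee_\gamma X:=\gamma(\bigvee X)$, $x+_\gamma y:=\gamma(x+y)$, $\mathsf0_\gamma:=\gamma(\mathsf0)$. -}

module Defs where

open import Level using (Level; _⊔_; suc)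
open import Data.Unit.Polymorphic using (⊤)
open import Data.Product using (Σ; _,_; proj₁; proj₂)
open import Relation.Binary.PropositionalEquality using (_≡_)
open import Relation.Binary.Structures using (IsPartialOrder)
open import Algebra.Structures using (IsMonoid)

-- The two parallel settings: plain (joins of arbitrary families) and
-- generalized (joins of non-empty families).
data Setting : Set where
  plain generalized : Setting

-- Which index types a family may have in the given setting.
-- Non-emptiness is witnessed by an element of the index type.
Adm : ∀ {ι} → Setting → Set ι → Set ι
Adm plain       I = ⊤
Adm generalized I = I

JoinOp : (s : Setting) (ι : Level) {q : Level} → Set q → Set (q ⊔ suc ι)
JoinOp s ι Q = (I : Set ι) → Adm s I → (I → Q) → Q

record IsQuantale (s : Setting) (ι : Level) {q : Level} (Q : Set q)
    (_≤_ : Q → Q → Set q) (⋁ : JoinOp s ι Q) (_+_ : Q → Q → Q) (𝟘 : Q)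
    : Set (q ⊔ suc ι) where
  field
    isPartialOrder : IsPartialOrder _≡_ _≤_
    ⋁-upper : ∀ I (ne : Adm s I) (f : I → Q) (i : I) → f i ≤ ⋁ I ne f
    ⋁-least : ∀ I (ne : Adm s I) (f : I → Q) (x : Q) →
              (∀ i → f i ≤ x) → ⋁ I ne f ≤ x
    isMonoid : IsMonoid _≡_ _+_ 𝟘
    +-mono : ∀ {x x′ y y′} → x ≤ x′ → y ≤ y′ → (x + y) ≤ (x′ + y′)
    +-distribˡ-⋁ : ∀ x I (ne : Adm s I) (f : I → Q) →
                   (x + ⋁ I ne f) ≡ ⋁ I ne (λ i → x + f i)
    +-distribʳ-⋁ : ∀ x I (ne : Adm s I) (f : I → Q) →
                   (⋁ I ne f + x) ≡ ⋁ I ne (λ i → f i + x)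

record AQM (s : Setting) (ι d a : Level) : Set (suc (ι ⊔ d ⊔ a)) where
  infixl 6 _+_
  infixl 7 _·_
  field
    Ad : Set d
    _·d_ : Ad → Ad → Ad
    1d : Ad
    Ad-isMonoid : IsMonoid _≡_ _·d_ 1d
    A : Set a
    _≤_ : A → A → Set a
    ⋁ : JoinOp s ι A
    _+_ : A → A → A
    𝟘 : A
    isQuantale : IsQuantale s ι A _≤_ ⋁ _+_ 𝟘
    _·_ : A → A → A
    𝟙 : A
    ·-isMonoid : IsMonoid _≡_ _·_ 𝟙
    -- the monoid homomorphism ι : A_d → A
    emb : Ad → A
    emb-· : ∀ x y → emb (x ·d y) ≡ emb x · emb y
    emb-1 : emb 1d ≡ 𝟙
    ·-distribʳ-⋁ : ∀ I (ne : Adm s I) (f : I → A) (b : A) →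
                   ⋁ I ne f · b ≡ ⋁ I ne (λ i → f i · b)
    ·-distribʳ-+ : ∀ x y z → (x + y) · z ≡ x · z + y · z
    ·-zeroˡ : ∀ x → 𝟘 · x ≡ 𝟘
    emb-distrib-⋁ : ∀ (e : Ad) I (ne : Adm s I) (f : I → A) →
                    emb e · ⋁ I ne f ≡ ⋁ I ne (λ i → emb e · f i)
    emb-distrib-+ : ∀ (e : Ad) x y → emb e · (x + y) ≡ emb e · x + emb e · y
    emb-zero : ∀ (e : Ad) → emb e · 𝟘 ≡ 𝟘

record IsModule {s : Setting} {ι d a : Level} (𝐀 : AQM s ι d a) {q : Level}
    (Q : Set q) (_≤_ : Q → Q → Set q) (⋁ : JoinOp s ι Q)
    (_+_ : Q → Q → Q) (𝟘 : Q) (_∗_ : AQM.A 𝐀 → Q → Q)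
    : Set (q ⊔ suc ι ⊔ d ⊔ a) where
  module 𝐀 = AQM 𝐀
  field
    isQuantale : IsQuantale s ι Q _≤_ ⋁ _+_ 𝟘
    ∗-mono : ∀ {a a′ x x′} → a 𝐀.≤ a′ → x ≤ x′ → (a ∗ x) ≤ (a′ ∗ x′)
    ∗-assoc : ∀ a b x → ((a 𝐀.· b) ∗ x) ≡ (a ∗ (b ∗ x))
    ∗-identity : ∀ x → (𝐀.𝟙 ∗ x) ≡ x
    ∗-distribʳ-+ : ∀ a b x → ((a 𝐀.+ b) ∗ x) ≡ ((a ∗ x) + (b ∗ x))
    ∗-zeroˡ : ∀ x → (𝐀.𝟘 ∗ x) ≡ 𝟘
    ∗-distribʳ-⋁ : ∀ I (ne : Adm s I) (f : I → 𝐀.A) (x : Q) →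
                   (𝐀.⋁ I ne f ∗ x) ≡ ⋁ I ne (λ i → f i ∗ x)
    emb-∗-+ : ∀ (e : 𝐀.Ad) x y → (𝐀.emb e ∗ (x + y)) ≡ ((𝐀.emb e ∗ x) + (𝐀.emb e ∗ y))
    emb-∗-zero : ∀ (e : 𝐀.Ad) → (𝐀.emb e ∗ 𝟘) ≡ 𝟘
    emb-∗-⋁ : ∀ (e : 𝐀.Ad) I (ne : Adm s I) (f : I → Q) →
              (𝐀.emb e ∗ ⋁ I ne f) ≡ ⋁ I ne (λ i → 𝐀.emb e ∗ f i)

record IsNucleus {q : Level} {Q : Set q} (_≤_ : Q → Q → Set q)
    (_+_ : Q → Q → Q) (γ : Q → Q) : Set q where
  field
    mono : ∀ {x y} → x ≤ y → γ x ≤ γ y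
    expansive : ∀ x → x ≤ γ x
    idempotent : ∀ x → γ (γ x) ≡ γ x
    +-lax : ∀ x y → (γ x + γ y) ≤ γ (x + y)

IsStructural : ∀ {a q} {A : Set a} {Q : Set q} (_≤_ : Q → Q → Set q)
  (_∗_ : A → Q → Q) (γ : Q → Q) → Set (a ⊔ q)
IsStructural {A = A} {Q} _≤_ _∗_ γ = ∀ (x : A) (y : Q) → (x ∗ γ y) ≤ γ (x ∗ y)

-- The quantale Q_γ on γ[Q] (represented as the fixed points of γ) and the
-- action a ∗_γ x := γ(a ∗ x).
module Quotient {s : Setting} {ι q : Level} {Q : Set q}
    (_≤_ : Q → Q → Set q) (⋁ : JoinOp s ι Q) (_+_ : Q → Q → Q) (𝟘 : Q)
    (γ : Q → Q) (idem : ∀ x → γ (γ x) ≡ γ x) where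

  Qγ : Set q
  Qγ = Σ Q (λ x → γ x ≡ x)

  ⌈_⌉ : Q → Qγ
  ⌈ x ⌉ = γ x , idem x

  _≤γ_ : Qγ → Qγ → Set q
  x ≤γ y = proj₁ x ≤ proj₁ y

  ⋁γ : JoinOp s ι Qγ
  ⋁γ I ne f = ⌈ ⋁ I ne (λ i → proj₁ (f i)) ⌉

  _+γ_ : Qγ → Qγ → Qγ
  x +γ y = ⌈ proj₁ x + proj₁ y ⌉

  𝟘γ : Qγ
  𝟘γ = ⌈ 𝟘 ⌉

  module Action {a : Level} {A : Set a} (_∗_ : A → Q → Q) where
    _∗γ_ : A → Qγ → Qγ
    x ∗γ y = ⌈ x ∗ proj₁ y ⌉

-- If x ≤ y ≤ γ x then γ y = γ x.  Laxness of + and structurality of ∗ put every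
-- operation applied to γ-images between the operation on the originals and its
-- γ-closure, so γ absorbs inner applications of γ.  Each axiom of Q_γ is then the
-- corresponding axiom of Q sandwiched between two such absorption identities.
module Submission where

open import Defs
open import Level using (Level)
open import Data.Product using (Σ; _,_; proj₁)
open import Function using (_∘′_)
open import Relation.Binary.PropositionalEquality
  using (_≡_; refl; sym; trans; cong; cong₂; subst; isEquivalence; module ≡-Reasoning)
open import Relation.Binary.Structures using (IsPartialOrder)
open import Algebra.Structures using (IsMonoid)
open import Axiom.UniquenessOfIdentityProofs.WithK using (uip)

fixedPoint-≡ : ∀ {q} {Q : Set q} {f : Q → Q} {x y : Σ Q (λ z → f z ≡ z)} →
               proj₁ x ≡ proj₁ y → x ≡ y
fixedPoint-≡ {x = x , p} {y = .x , p′} refl = cong (x ,_) (uip p p′)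

module ClosureOperator {q ℓ} {Q : Set q} {_≤_ : Q → Q → Set ℓ}
    (isPartialOrder : IsPartialOrder _≡_ _≤_) (γ : Q → Q)
    (mono : ∀ {x y} → x ≤ y → γ x ≤ γ y) (expansive : ∀ x → x ≤ γ x)
    (idempotent : ∀ x → γ (γ x) ≡ γ x) where

  open IsPartialOrder isPartialOrder using (antisym)

  γ-lift : ∀ {x y} → x ≤ γ y → γ x ≤ γ y
  γ-lift {x} {y} x≤γy = subst (γ x ≤_) (idempotent y) (mono x≤γy)

  γ-squeeze : ∀ {x y} → x ≤ y → y ≤ γ x → γ y ≡ γ x
  γ-squeeze x≤y y≤γx = antisym (γ-lift y≤γx) (mono x≤y)

module NucleusQuotient {s : Setting} {ι q : Level} {Q : Set q}
    {_≤_ : Q → Q → Set q} {⋁ : JoinOp s ι Q} {_+_ : Q → Q → Q} {𝟘 : Q}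
    (isQuantale : IsQuantale s ι Q _≤_ ⋁ _+_ 𝟘)
    {γ : Q → Q} (nuc : IsNucleus _≤_ _+_ γ) where

  open IsQuantale isQuantale
  open IsPartialOrder isPartialOrder using (antisym)
    renaming (refl to ≤-refl; trans to ≤-trans)
  open IsMonoid isMonoid using ()
    renaming (assoc to +-assoc; identityˡ to +-identityˡ; identityʳ to +-identityʳ)
  open IsNucleus nuc
  open ClosureOperator isPartialOrder γ mono expansive idempotent public
  open Quotient _≤_ ⋁ _+_ 𝟘 γ idempotent

  γ-+-γ : ∀ x y → γ (γ x + γ y) ≡ γ (x + y)
  γ-+-γ x y = γ-squeeze (+-mono (expansive x) (expansive y)) (+-lax x y)

  γ-+ˡ : ∀ x y → γ (γ x + y) ≡ γ (x + y)
  γ-+ˡ x y = γ-squeeze (+-mono (expansive x) ≤-refl)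
                       (≤-trans (+-mono ≤-refl (expansive y)) (+-lax x y))

  γ-+ʳ : ∀ x y → γ (x + γ y) ≡ γ (x + y)
  γ-+ʳ x y = γ-squeeze (+-mono ≤-refl (expansive y))
                       (≤-trans (+-mono (expansive x) ≤-refl) (+-lax x y))

  γ-⋁-γ : ∀ I ne (f : I → Q) → γ (⋁ I ne (λ i → γ (f i))) ≡ γ (⋁ I ne f)
  γ-⋁-γ I ne f = γ-squeeze
    (⋁-least I ne f _ (λ i → ≤-trans (expansive (f i)) (⋁-upper I ne _ i)))
    (⋁-least I ne _ _ (λ i → mono (⋁-upper I ne f i)))

  +γ-assoc : ∀ x y z → (x +γ y) +γ z ≡ x +γ (y +γ z)
  +γ-assoc (x , _) (y , _) (z , _) = fixedPoint-≡ (begin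
    γ (γ (x + y) + z)  ≡⟨ γ-+ˡ (x + y) z ⟩
    γ ((x + y) + z)    ≡⟨ cong γ (+-assoc x y z) ⟩
    γ (x + (y + z))    ≡⟨ γ-+ʳ x (y + z) ⟨
    γ (x + γ (y + z))  ∎)
    where open ≡-Reasoning

  +γ-identityˡ : ∀ x → 𝟘γ +γ x ≡ x
  +γ-identityˡ (x , γx≡x) =
    fixedPoint-≡ (trans (γ-+ˡ 𝟘 x) (trans (cong γ (+-identityˡ x)) γx≡x))

  +γ-identityʳ : ∀ x → x +γ 𝟘γ ≡ x
  +γ-identityʳ (x , γx≡x) =
    fixedPoint-≡ (trans (γ-+ʳ x 𝟘) (trans (cong γ (+-identityʳ x)) γx≡x))

  +γ-distribˡ-⋁γ : ∀ x I ne (f : I → Qγ) → x +γ ⋁γ I ne f ≡ ⋁γ I ne (λ i → x +γ f i)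
  +γ-distribˡ-⋁γ (x , _) I ne f = fixedPoint-≡ (begin
    γ (x + γ (⋁ I ne (proj₁ ∘′ f)))           ≡⟨ γ-+ʳ x _ ⟩
    γ (x + ⋁ I ne (proj₁ ∘′ f))               ≡⟨ cong γ (+-distribˡ-⋁ x I ne _) ⟩
    γ (⋁ I ne (λ i → x + proj₁ (f i)))        ≡⟨ γ-⋁-γ I ne _ ⟨
    γ (⋁ I ne (λ i → γ (x + proj₁ (f i))))    ∎)
    where open ≡-Reasoning

  +γ-distribʳ-⋁γ : ∀ x I ne (f : I → Qγ) → ⋁γ I ne f +γ x ≡ ⋁γ I ne (λ i → f i +γ x)
  +γ-distribʳ-⋁γ (x , _) I ne f = fixedPoint-≡ (begin
    γ (γ (⋁ I ne (proj₁ ∘′ f)) + x)           ≡⟨ γ-+ˡ _ x ⟩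
    γ (⋁ I ne (proj₁ ∘′ f) + x)               ≡⟨ cong γ (+-distribʳ-⋁ x I ne _) ⟩
    γ (⋁ I ne (λ i → proj₁ (f i) + x))        ≡⟨ γ-⋁-γ I ne _ ⟨
    γ (⋁ I ne (λ i → γ (proj₁ (f i) + x)))    ∎)
    where open ≡-Reasoning

  Qγ-isPartialOrder : IsPartialOrder _≡_ _≤γ_
  Qγ-isPartialOrder = record
    { isPreorder = record
      { isEquivalence = isEquivalence
      ; reflexive = λ { refl → ≤-refl }
      ; trans = ≤-trans
      }
    ; antisym = λ x≤y y≤x → fixedPoint-≡ (antisym x≤y y≤x)
    }

  Qγ-isQuantale : IsQuantale s ι Qγ _≤γ_ ⋁γ _+γ_ 𝟘γ
  Qγ-isQuantale = record
    { isPartialOrder = Qγ-isPartialOrder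
    ; ⋁-upper = λ I ne f i → ≤-trans (⋁-upper I ne _ i) (expansive _)
    ; ⋁-least = λ I ne f (x , γx≡x) fᵢ≤x →
        subst (γ (⋁ I ne (proj₁ ∘′ f)) ≤_) γx≡x (mono (⋁-least I ne _ x fᵢ≤x))
    ; isMonoid = record
      { isSemigroup = record
        { isMagma = record { isEquivalence = isEquivalence ; ∙-cong = cong₂ _+γ_ }
        ; assoc = +γ-assoc
        }
      ; identity = +γ-identityˡ , +γ-identityʳ
      }
    ; +-mono = λ x≤x′ y≤y′ → mono (+-mono x≤x′ y≤y′)
    ; +-distribˡ-⋁ = +γ-distribˡ-⋁γ
    ; +-distribʳ-⋁ = +γ-distribʳ-⋁γ
    }

module StructuralNucleusQuotient {s : Setting} {ι d a q : Level} (𝐀 : AQM s ι d a)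
    {Q : Set q} {_≤_ : Q → Q → Set q} {⋁ : JoinOp s ι Q} {_+_ : Q → Q → Q} {𝟘 : Q}
    {_∗_ : AQM.A 𝐀 → Q → Q} (isModule : IsModule 𝐀 Q _≤_ ⋁ _+_ 𝟘 _∗_)
    {γ : Q → Q} (nuc : IsNucleus _≤_ _+_ γ) (structural : IsStructural _≤_ _∗_ γ) where

  open IsModule isModule
  open IsPartialOrder (IsQuantale.isPartialOrder (AQM.isQuantale 𝐀))
    using () renaming (refl to ≤ᴬ-refl)
  open IsNucleus nuc
  open NucleusQuotient isQuantale nuc
  open Quotient _≤_ ⋁ _+_ 𝟘 γ idempotent
  open Action _∗_

  γ-∗-γ : ∀ b x → γ (b ∗ γ x) ≡ γ (b ∗ x)
  γ-∗-γ b x = γ-squeeze (∗-mono ≤ᴬ-refl (expansive x)) (structural b x)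

  Qγ-isModule : IsModule 𝐀 Qγ _≤γ_ ⋁γ _+γ_ 𝟘γ _∗γ_
  Qγ-isModule = record
    { isQuantale = Qγ-isQuantale
    ; ∗-mono = λ b≤b′ x≤x′ → mono (∗-mono b≤b′ x≤x′)
    ; ∗-assoc = λ b c x → fixedPoint-≡
        (trans (cong γ (∗-assoc b c _)) (sym (γ-∗-γ b _)))
    ; ∗-identity = λ (x , γx≡x) → fixedPoint-≡ (trans (cong γ (∗-identity x)) γx≡x)
    ; ∗-distribʳ-+ = λ b c x → fixedPoint-≡
        (trans (cong γ (∗-distribʳ-+ b c _)) (sym (γ-+-γ _ _)))
    ; ∗-zeroˡ = λ x → fixedPoint-≡ (cong γ (∗-zeroˡ _))
    ; ∗-distribʳ-⋁ = λ I ne f x → fixedPoint-≡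
        (trans (cong γ (∗-distribʳ-⋁ I ne f _)) (sym (γ-⋁-γ I ne _)))
    ; emb-∗-+ = λ e x y → fixedPoint-≡
        (trans (γ-∗-γ _ _) (trans (cong γ (emb-∗-+ e _ _)) (sym (γ-+-γ _ _))))
    ; emb-∗-zero = λ e → fixedPoint-≡ (trans (γ-∗-γ _ _) (cong γ (emb-∗-zero e)))
    ; emb-∗-⋁ = λ e I ne f → fixedPoint-≡
        (trans (γ-∗-γ _ _) (trans (cong γ (emb-∗-⋁ e I ne _)) (sym (γ-⋁-γ I ne _))))
    }

lemma5p9 : ∀ {s : Setting} {ι d a q : Level} (𝐀 : AQM s ι d a)
    {Q : Set q} (_≤_ : Q → Q → Set q) (⋁ : JoinOp s ι Q) (_+_ : Q → Q → Q) (𝟘 : Q)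
    (_∗_ : AQM.A 𝐀 → Q → Q) → IsModule 𝐀 Q _≤_ ⋁ _+_ 𝟘 _∗_ →
    (γ : Q → Q) (nuc : IsNucleus _≤_ _+_ γ) → IsStructural _≤_ _∗_ γ →
    let open Quotient _≤_ ⋁ _+_ 𝟘 γ (IsNucleus.idempotent nuc)
        open Action _∗_
    in IsModule 𝐀 Qγ _≤γ_ ⋁γ _+γ_ 𝟘γ _∗γ_
lemma5p9 𝐀 _ _ _ _ _ isModule _ nuc structural =
  StructuralNucleusQuotient.Qγ-isModule 𝐀 isModule nuc structural
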